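{- $\mathfrak{b}_{\mathrm{game}^\ast}^{\mathrm{II}} = \mathfrak{c}$.
   Context: For $\mathcal{A} \subseteq \omega^\omega$, the bounding* game with respect to $\mathcal{A}$ is the following infinite game of length $\omega$: in round $k$, Player I plays $n_k \in \omega$ and then Player II plays $m_k \in \omega$. Player II wins the play if $\langle m_k : k \in \omega\rangle \in \mathcal{A}$ and $n_k < m_k$ for infinitely many $k$; otherwise Player I wins. Strategies and winning strategies are meant in the usual sense. Define $\mathfrak{b}_{\mathrm{game}^\ast}^{\mathrm{II}} = \min\{|\mathcal{A}| : \mathcal{A} \subseteq \omega^\omega \text{ and Player II has a winning strategy in the bounding* game with respect to } \mathcal{A}\}$. $\mathfrak{c}$ denotes the cardinality of the continuum. -}

module Defs where

open import Data.Nat using (ℕ; zero; suc; _<_; _≤_)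
open import Data.Product using (Σ; _×_; ∃-syntax; proj₁)
open import Data.List using (List; []; _∷_; _++_; [_])
open import Relation.Binary.PropositionalEquality using (_≡_)

Baire : Set
Baire = ℕ → ℕ

Family : Set₁
Family = Baire → Set

-- A strategy for Player II: given the full history of the previous rounds
-- (list of pairs (n_i , m_i), i < k) and Player I's current move n_k,
-- it returns Player II's move m_k.
StrategyII : Set
StrategyII = List (ℕ × ℕ) → ℕ → ℕ

history : StrategyII → Baire → ℕ → List (ℕ × ℕ)
response : StrategyII → Baire → ℕ → ℕ

history σ x zero = []
history σ x (suc k) = history σ x k ++ [ (x k Data.Product., response σ x k) ]
response σ x k = σ (history σ x k) (x k)

InfinitelyOften : (ℕ → Set) → Set
InfinitelyOften P = ∀ (N : ℕ) → ∃[ k ] (N ≤ k × P k)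

WinningII : Family → StrategyII → Set
WinningII A σ = ∀ (x : Baire) →
  A (response σ x) × InfinitelyOften (λ k → x k < response σ x k)

-- c ≤ |A|: an injection of ω^ω into A (elements of A compared by their
-- underlying functions, extensionally).
ContinuumLeCard : Family → Set
ContinuumLeCard A =
  Σ (Baire → Σ Baire A) λ f →
    ∀ (x y : Baire) → (∀ n → proj₁ (f x) n ≡ proj₁ (f y) n) → ∀ n → x n ≡ y n

-- Player I can force II to spell out an arbitrary binary sequence in her replies.  Writing
-- a for II's reply to 0 at the current position, either II answers a with a again, and I
-- plays a (II cannot win that round), or II's replies to 0 and to a differ, and I plays 0
-- or a according to the next bit of the sequence.  Since II must win infinitely many rounds,
-- infinitely many rounds are of the second kind, so every bit is eventually read and the
-- replies determine the sequence.  Composing with an injection of ω^ω into 2^ω gives c many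
-- distinct plays by II, all in A.  Conversely, II wins on A = ω^ω by replying n + 1.
module Submission where

open import Defs
open import Data.Bool using (Bool; true; false; T; if_then_else_)
open import Data.Empty using (⊥-elim)
open import Data.List using (List; []; _++_; [_])
open import Data.Nat
  using (ℕ; zero; suc; _+_; _≤_; _<_; _≤′_; ≤′-refl; ≤′-step; _≟_; _≡ᵇ_; z≤n; s≤s)
open import Data.Nat.Properties
  using (≤-refl; ≤-trans; ≤⇒≤′; n≤1+n; <-irrefl; +-suc; +-identityʳ; m<1+n⇒m<n∨m≡n; ≡ᵇ⇒≡; ≡⇒≡ᵇ)
open import Data.Product using (Σ; _×_; _,_; proj₁; proj₂; ∃-syntax; map; map₂; uncurry)
open import Data.Sum using (_⊎_; inj₁; inj₂) renaming (map₂ to ⊎-map₂)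
open import Data.Unit using (⊤; tt)
open import Function using (_∘_)
open import Relation.Nullary using (¬_; yes; no)
open import Relation.Binary.PropositionalEquality using (_≡_; refl; sym; trans; cong; subst)

successor-wins-everything : Σ Family λ A → Σ StrategyII λ σ → WinningII A σ
successor-wins-everything =
  (λ _ → ⊤) , (λ _ n → suc n) , λ _ → tt , λ N → N , ≤-refl , ≤-refl

Cantor : Set
Cantor = ℕ → Bool

nextPair : ℕ × ℕ → ℕ × ℕ
nextPair (i , zero)  = 0 , suc i
nextPair (i , suc j) = suc i , j

-- Enumerates ℕ × ℕ diagonal by diagonal: (0 , s), (1 , s - 1), …, (s , 0), (0 , s + 1), …
unpair : ℕ → ℕ × ℕ
unpair zero    = 0 , 0
unpair (suc n) = nextPair (unpair n)

unpair-descends : ∀ i j → ∃[ n ] unpair n ≡ (0 , i + j) → ∃[ m ] unpair m ≡ (i , j)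
unpair-descends zero    j p = p
unpair-descends (suc i) j p =
  map suc (cong nextPair)
    (unpair-descends i (suc j) (map₂ (λ e → trans e (cong (0 ,_) (sym (+-suc i j)))) p))

unpair-diagonal : ∀ s → ∃[ n ] unpair n ≡ (0 , s)
unpair-diagonal zero    = 0 , refl
unpair-diagonal (suc s) =
  map suc (cong nextPair)
    (unpair-descends s 0
      (map₂ (λ e → trans e (cong (0 ,_) (sym (+-identityʳ s)))) (unpair-diagonal s)))

unpair-surjective : ∀ i j → ∃[ n ] unpair n ≡ (i , j)
unpair-surjective i j = unpair-descends i j (unpair-diagonal (i + j))

graph : Baire → Cantor
graph y n = uncurry (λ i j → y i ≡ᵇ j) (unpair n)

graph-injective : ∀ x y → (∀ n → graph x n ≡ graph y n) → ∀ i → x i ≡ y i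
graph-injective x y same i with unpair-surjective i (x i)
... | n , unpair-n =
  sym (≡ᵇ⇒≡ (y i) (x i) (subst T (trans (sym (graph-at x)) (trans (same n) (graph-at y)))
                                 (≡⇒≡ᵇ (x i) (x i) refl)))
  where
  graph-at : ∀ z → graph z n ≡ (z i ≡ᵇ x i)
  graph-at z = cong (uncurry (λ i j → z i ≡ᵇ j)) unpair-n

-- A round is represented by II's reply function r at the current history.
Stalls : (ℕ → ℕ) → Set
Stalls r = r (r 0) ≡ r 0

probe : (ℕ → ℕ) → Bool → ℕ
probe r bit with r (r 0) ≟ r 0
... | yes _ = r 0
... | no  _ = if bit then r 0 else 0

advance : (ℕ → ℕ) → ℕ → ℕ
advance r c with r (r 0) ≟ r 0
... | yes _ = c
... | no  _ = suc c

probe-won⇒¬stalls : ∀ r bit → probe r bit < r (probe r bit) → ¬ Stalls r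
probe-won⇒¬stalls r bit won stalls with r (r 0) ≟ r 0
... | yes _      = <-irrefl (sym stalls) won
... | no ¬stalls = ¬stalls stalls

probe-reply-injective : ∀ r b b' → r (probe r b) ≡ r (probe r b') →
                        probe r b ≡ probe r b' × (¬ Stalls r → b ≡ b')
probe-reply-injective r b b' e with r (r 0) ≟ r 0
... | yes stalls = refl , λ ¬stalls → ⊥-elim (¬stalls stalls)
probe-reply-injective r true  true  e | no ¬stalls = refl , λ _ → refl
probe-reply-injective r false false e | no ¬stalls = refl , λ _ → refl
probe-reply-injective r true  false e | no ¬stalls = ⊥-elim (¬stalls e)
probe-reply-injective r false true  e | no ¬stalls = ⊥-elim (¬stalls (sym e))

≤-advance : ∀ r c → c ≤ advance r c
≤-advance r c with r (r 0) ≟ r 0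
... | yes _ = ≤-refl
... | no  _ = n≤1+n c

advance-¬stalls : ∀ r c → ¬ Stalls r → advance r c ≡ suc c
advance-¬stalls r c ¬stalls with r (r 0) ≟ r 0
... | yes stalls = ⊥-elim (¬stalls stalls)
... | no  _      = refl

<-advance⇒<∨¬stalls : ∀ r c {i} → i < advance r c → i < c ⊎ (¬ Stalls r × i ≡ c)
<-advance⇒<∨¬stalls r c i<c′ with r (r 0) ≟ r 0
... | yes _      = inj₁ i<c′
... | no ¬stalls = ⊎-map₂ (¬stalls ,_) (m<1+n⇒m<n∨m≡n i<c′)

WinsInfinitelyOften : StrategyII → Set
WinsInfinitelyOften σ = ∀ x → InfinitelyOften (λ k → x k < response σ x k)

record Position : Set where
  constructor ⟨_,_⟩
  field
    past     : List (ℕ × ℕ)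
    bitsRead : ℕ
open Position

module BitCoding (σ : StrategyII) where

  after : Position → ℕ → Position
  after p m = ⟨ past p ++ [ (m , σ (past p) m) ] , advance (σ (past p)) (bitsRead p) ⟩

  move : Cantor → Position → ℕ
  move b p = probe (σ (past p)) (b (bitsRead p))

  position : Cantor → ℕ → Position
  position b zero    = ⟨ [] , 0 ⟩
  position b (suc k) = after (position b k) (move b (position b k))

  play : Cantor → Baire
  play b k = move b (position b k)

  replyAt : Cantor → ℕ → ℕ → ℕ
  replyAt b k = σ (past (position b k))

  readAt : Cantor → ℕ → ℕ
  readAt b k = bitsRead (position b k)

  Splitting : Cantor → ℕ → Set
  Splitting b k = ¬ Stalls (replyAt b k)

  history-play : ∀ b k → history σ (play b) k ≡ past (position b k)
  history-play b zero    = refl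
  history-play b (suc k) = cong (λ h → h ++ [ (play b k , σ h (play b k)) ]) (history-play b k)

  response-play : ∀ b k → response σ (play b) k ≡ replyAt b k (play b k)
  response-play b k = cong (λ h → σ h (play b k)) (history-play b k)

  readAt-mono : ∀ b {k l} → k ≤ l → readAt b k ≤ readAt b l
  readAt-mono b k≤l = go (≤⇒≤′ k≤l)
    where
    go : ∀ {k l} → k ≤′ l → readAt b k ≤ readAt b l
    go ≤′-refl                    = ≤-refl
    go {l = suc l} (≤′-step k≤′l) = ≤-trans (go k≤′l) (≤-advance (replyAt b l) (readAt b l))

  read-at-splitting : ∀ b K {i} → i < readAt b K → ∃[ k ] Splitting b k × readAt b k ≡ i
  read-at-splitting b (suc K) i<read with <-advance⇒<∨¬stalls (replyAt b K) (readAt b K) i<read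
  ... | inj₁ i<read′          = read-at-splitting b K i<read′
  ... | inj₂ (splitting , i≡) = K , splitting , sym i≡

  module _ (wins-io : WinsInfinitelyOften σ) (b : Cantor) where

    splitting-infinitely-often : InfinitelyOften (Splitting b)
    splitting-infinitely-often N with wins-io (play b) N
    ... | k , N≤k , II-wins =
      k , N≤k , probe-won⇒¬stalls (replyAt b k) (b (readAt b k))
                  (subst (play b k <_) (response-play b k) II-wins)

    readAt-unbounded : ∀ i → ∃[ k ] i ≤ readAt b k
    readAt-unbounded zero = 0 , z≤n
    readAt-unbounded (suc i) with readAt-unbounded i
    ... | k , i≤read with splitting-infinitely-often k
    ... | l , k≤l , splitting =
      suc l , subst (suc i ≤_) (sym (advance-¬stalls (replyAt b l) (readAt b l) splitting))
                    (s≤s (≤-trans i≤read (readAt-mono b k≤l)))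

    every-bit-read-at-splitting : ∀ i → ∃[ k ] Splitting b k × readAt b k ≡ i
    every-bit-read-at-splitting i with readAt-unbounded (suc i)
    ... | K , i<read = read-at-splitting b K i<read

  module _ {b b' : Cantor}
           (same-replies : ∀ k → response σ (play b) k ≡ response σ (play b') k) where

    positions-agree : ∀ k → position b k ≡ position b' k

    replies-agree : ∀ k → replyAt b k (play b k)
                        ≡ replyAt b k (probe (replyAt b k) (b' (readAt b k)))
    replies-agree k =
      trans (sym (response-play b k)) (trans (same-replies k) (trans (response-play b' k)
        (cong (λ p → σ (past p) (move b' p)) (sym (positions-agree k)))))

    probes-agree : ∀ k → play b k ≡ move b' (position b k)
                       × (Splitting b k → b (readAt b k) ≡ b' (readAt b k))
    probes-agree k =
      probe-reply-injective (replyAt b k) (b (readAt b k)) (b' (readAt b k)) (replies-agree k)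

    positions-agree zero    = refl
    positions-agree (suc k) =
      trans (cong (after (position b k)) (proj₁ (probes-agree k)))
            (cong (λ p → after p (move b' p)) (positions-agree k))

  replies-determine-bits : WinsInfinitelyOften σ → ∀ {b b'} →
                           (∀ k → response σ (play b) k ≡ response σ (play b') k) → ∀ i → b i ≡ b' i
  replies-determine-bits wins-io {b} same-replies i with every-bit-read-at-splitting wins-io b i
  ... | k , splitting , refl = proj₂ (probes-agree same-replies k) splitting

winning⇒continuum≤ : ∀ (A : Family) (σ : StrategyII) → WinningII A σ → ContinuumLeCard A
winning⇒continuum≤ A σ won =
  (λ y → response σ (play (graph y)) , proj₁ (won (play (graph y)))) ,
  λ x y same-replies → graph-injective x y (replies-determine-bits (proj₂ ∘ won) same-replies)
  where open BitCoding σ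

theorem2p5 : (Σ Family λ A → Σ StrategyII λ σ → WinningII A σ)
    × (∀ (A : Family) (σ : StrategyII) → WinningII A σ → ContinuumLeCard A)
theorem2p5 = successor-wins-everything , winning⇒continuum≤
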